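{- Let $n \geq 3$ and let $T \in \mathcal{Y}_n$ have shape $(n)$ (a single row) or shape $(1,1,\ldots,1)$ (a single column). Then $T$ is reconstructible from its set of $1$-minors: if $T' \in \mathcal{Y}_n$ has the same set of $1$-minors as $T$, then $T' = T$.
   Context: A partition $\lambda$ of $n$ is a non-increasing finite sequence $(\lambda_1,\ldots,\lambda_m)$ of positive integers summing to $n$; its Young diagram is a left-aligned array of cells with $\lambda_h$ cells in row $h$ (rows counted from the top). A standard Young tableau of shape $\lambda$ is a filling of the Young diagram of $\lambda$ with $1,\ldots,n$, each exactly once, increasing left to right along rows and top to bottom down columns; $\mathcal{Y}_n$ denotes the set of standard Young tableaux with $n$ entries. For $T \in \mathcal{Y}_n$ and $m \in \{1,\ldots,n\}$, the tableau $T - m \in \mathcal{Y}_{n-1}$ is obtained as follows: remove the cell containing $m$, leaving a space; repeatedly, let $R$ be the cell immediately right of the space and $B$ the cell immediately below it (if they exist); if $R$ exists and ($B$ does not exist or the entry of $R$ is smaller than that of $B$), slide $R$ into the space; otherwise, if $B$ exists, slide $B$ into the space; if neither exists, stop (jeu de taquin). Finally renumber every entry $p > m$ as $p-1$. The set of $1$-minors of $T$ is $\{T - m : 1 \leq m \leq n\}$. -}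

module Defs where

open import Data.Nat using (ℕ; zero; suc; _<_; _≤_; _<ᵇ_; _≡ᵇ_; pred)
open import Data.Bool using (Bool; true; false; if_then_else_)
open import Data.List using (List; []; _∷_; _++_; [_]; length; take; drop; map; concat; upTo; replicate)
open import Data.List.Relation.Unary.All using (All)
open import Data.List.Relation.Unary.Linked using (Linked)
open import Data.List.Relation.Binary.Permutation.Propositional using (_↭_)
open import Data.Maybe using (Maybe; just; nothing)
open import Data.Product using (Σ; _×_; _,_)
open import Data.Unit using (⊤)
open import Data.Empty using (⊥)
open import Relation.Binary.PropositionalEquality using (_≡_)

-- A tableau is represented by its list of rows, top row first,
-- each row listed left to right.
Tableau : Set
Tableau = List (List ℕ)

shape : Tableau → List ℕ
shape = map length

NonEmpty : List ℕ → Set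
NonEmpty []      = ⊥
NonEmpty (_ ∷ _) = ⊤

Below : List ℕ → List ℕ → Set
Below _        []       = ⊤
Below []       (_ ∷ _)  = ⊥
Below (a ∷ as) (b ∷ bs) = (a < b) × Below as bs

Geq : ℕ → ℕ → Set
Geq a b = b ≤ a

record IsSYT (n : ℕ) (T : Tableau) : Set where
  field
    rowsNonEmpty : All NonEmpty T
    partition    : Linked Geq (shape T)
    rowsIncr     : All (Linked _<_) T
    colsIncr     : Linked Below T
    entries      : concat T ↭ map suc (upTo n)

lookupM : List ℕ → ℕ → Maybe ℕ
lookupM []       _       = nothing
lookupM (x ∷ _)  zero    = just x
lookupM (_ ∷ xs) (suc i) = lookupM xs i

stop : List ℕ → Tableau → Tableau
stop []        rows = rows
stop (x ∷ pre) rows = (x ∷ pre) ∷ rows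

-- jeu de taquin: the current row is  pre ++ [hole] ++ suf.
-- slide₀: no row below the hole row.
slide₀ : List ℕ → List ℕ → Tableau
slide₀ pre []      = stop pre []
slide₀ pre (r ∷ s) = slide₀ (pre ++ [ r ]) s

mutual
  -- slide₁ pre suf row rows: hole row is  pre ++ [hole] ++ suf, the row directly
  -- below is  row , the further rows are  rows .
  slide₁ : List ℕ → List ℕ → List ℕ → Tableau → Tableau
  slide₁ pre suf row rows = step pre suf row rows (lookupM row (length pre))

  step : List ℕ → List ℕ → List ℕ → Tableau → Maybe ℕ → Tableau
  step pre []      row rows nothing  = stop pre (row ∷ rows)
  step pre []      row rows (just b) = (pre ++ [ b ]) ∷ descend (length pre) row rows
  step pre (r ∷ s) row rows nothing  = slide₁ (pre ++ [ r ]) s row rows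
  step pre (r ∷ s) row rows (just b) with r <ᵇ b
  ... | true  = slide₁ (pre ++ [ r ]) s row rows
  ... | false = (pre ++ b ∷ r ∷ s) ∷ descend (length pre) row rows

  -- the hole has moved down into  row  at column c
  descend : ℕ → List ℕ → Tableau → Tableau
  descend c row []            = slide₀ (take c row) (drop (suc c) row)
  descend c row (row′ ∷ rows) = slide₁ (take c row) (drop (suc c) row) row′ rows

slide : List ℕ → List ℕ → Tableau → Tableau
slide pre suf []           = slide₀ pre suf
slide pre suf (row ∷ rows) = slide₁ pre suf row rows

splitAt : ℕ → List ℕ → Maybe (List ℕ × List ℕ)
splitAt m [] = nothing
splitAt m (x ∷ xs) with m ≡ᵇ x
... | true  = just ([] , xs)
... | false with splitAt m xs
...   | nothing        = nothing
...   | just (p , s)   = just (x ∷ p , s)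

removeCell : ℕ → Tableau → Tableau
removeCell m []       = []
removeCell m (r ∷ rs) with splitAt m r
... | nothing       = r ∷ removeCell m rs
... | just (p , s)  = slide p s rs

renumber : ℕ → ℕ → ℕ
renumber m p = if m <ᵇ p then pred p else p

_minus_ : Tableau → ℕ → Tableau
T minus m = map (map (renumber m)) (removeCell m T)

IsMinor : ℕ → Tableau → Tableau → Set
IsMinor n T S = Σ ℕ λ m → (1 ≤ m) × (m ≤ n) × (S ≡ T minus m)

RowOrColumn : ℕ → Tableau → Set
RowOrColumn n T = (shape T ≡ n ∷ []) Data.Sum.⊎ (shape T ≡ replicate n 1)
  where import Data.Sum

-- Every 1-minor of a single row (column) is a single row (column), and the shape of
-- a minor survives the renumbering, so all removals from T′ have that shape as well.
-- The largest entry n of T′ sits at a corner, hence T′ − n is T′ with that cell deleted;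
-- this leaves T′ a row (column) or of shape (n − 1, 1) (resp. (2, 1, …, 1)), and there,
-- as n ≥ 3, removing the second entry of the first row (resp. its first entry) gives a
-- minor of the wrong shape.
-- A row or column SYT is determined by its entries, listed in increasing order.
module Submission where

open import Defs
open import Data.Nat using (ℕ; zero; suc; _≤_; _<_; _<ᵇ_; _≡ᵇ_; z≤n; s≤s)
open import Data.Nat.Properties
  using (≡ᵇ⇒≡; ≡⇒≡ᵇ; <ᵇ⇒<; <⇒≱; >⇒≢; <⇒≤; ≤-trans; ≤-refl; ≤-totalOrder; 1+n≰n; m<n⇒0<n)
open import Data.Bool using (true; false)
open import Data.Bool.Properties using (T-≡)
open import Data.List using (List; []; _∷_; _++_; [_]; length; map; concat; upTo; replicate)
open import Data.List.Properties using (length-map; length-upTo; map-∘; map-cong; ++-assoc; ++-identityʳ)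
open import Data.List.Relation.Unary.All using (All; []; _∷_)
import Data.List.Relation.Unary.All.Properties as All
import Data.List.Relation.Unary.AllPairs as AllPairs
open import Data.List.Relation.Unary.Any using (here; there)
open import Data.List.Relation.Unary.Linked as Linked using (Linked; []; _∷_)
import Data.List.Relation.Unary.Linked.Properties as Linkedₚ
open import Data.List.Relation.Unary.Sorted.TotalOrder.Properties using (↗↭↗⇒≋)
open import Data.List.Relation.Binary.Equality.Propositional using (≋⇒≡)
open import Data.List.Relation.Binary.Permutation.Propositional using (_↭_; ↭-sym; ↭-trans; ↭⇒↭ₛ)
open import Data.List.Relation.Binary.Permutation.Propositional.Properties using (↭-length; ∈-resp-↭)
open import Data.List.Membership.Propositional using (_∈_; _∉_)
open import Data.List.Membership.Propositional.Properties
  using (∈-map⁻; ∈-map⁺; ∈-upTo⁻; ∈-upTo⁺; ∈-++⁺ˡ; ∈-++⁺ʳ; ∈-++⁻)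
open import Data.Maybe using (just; nothing)
open import Data.Product using (∃-syntax; _×_; _,_; proj₁; proj₂)
open import Data.Sum using (inj₁; inj₂)
open import Data.Empty using (⊥-elim)
open import Relation.Nullary using (¬_)
open import Relation.Binary.PropositionalEquality
  using (_≡_; _≢_; refl; sym; trans; cong; subst; subst₂; module ≡-Reasoning)
open import Function.Bundles using (_⇔_; Equivalence)

≡ᵇ-true⇒≡ : ∀ {m n} → (m ≡ᵇ n) ≡ true → m ≡ n
≡ᵇ-true⇒≡ {m} {n} eq = ≡ᵇ⇒≡ m n (Equivalence.from T-≡ eq)

≡ᵇ-refl : ∀ m → (m ≡ᵇ m) ≡ true
≡ᵇ-refl m = Equivalence.to T-≡ (≡⇒≡ᵇ m m refl)

≢⇒≡ᵇ-false : ∀ {m n} → m ≢ n → (m ≡ᵇ n) ≡ false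
≢⇒≡ᵇ-false {m} {n} m≢n with m ≡ᵇ n in eq
... | true  = ⊥-elim (m≢n (≡ᵇ-true⇒≡ eq))
... | false = refl

≤⇒<ᵇ-false : ∀ {m n} → n ≤ m → (m <ᵇ n) ≡ false
≤⇒<ᵇ-false {m} {n} n≤m with m <ᵇ n in eq
... | true  = ⊥-elim (<⇒≱ (<ᵇ⇒< m n (Equivalence.from T-≡ eq)) n≤m)
... | false = refl

↗↭↗⇒≡ : {xs ys : List ℕ} → Linked _<_ xs → Linked _<_ ys → xs ↭ ys → xs ≡ ys
↗↭↗⇒≡ xs↗ ys↗ xs↭ys =
  ≋⇒≡ (↗↭↗⇒≋ ≤-totalOrder (Linked.map <⇒≤ xs↗) (Linked.map <⇒≤ ys↗) (↭⇒↭ₛ xs↭ys))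

Linked-<-adjacent : ∀ pre {x y} suf → Linked _<_ (pre ++ x ∷ y ∷ suf) → x < y
Linked-<-adjacent []      suf (x<y ∷ _) = x<y
Linked-<-adjacent (_ ∷ pre) suf ↗       = Linked-<-adjacent pre suf (Linked.tail ↗)

rows-no-longer-than-first : ∀ {y X} → Linked Geq (shape (y ∷ X)) → All (λ r → length r ≤ length y) X
rows-no-longer-than-first part =
  All.map⁻ (AllPairs.head (Linkedₚ.Linked⇒AllPairs (λ b≤a c≤b → ≤-trans c≤b b≤a) part))

IsColumn : Tableau → Set
IsColumn = All (λ r → length r ≡ 1)

length-resp-shape : ∀ {X Y : Tableau} → shape X ≡ shape Y → length X ≡ length Y
length-resp-shape {X} {Y} eq = trans (sym (length-map length X)) (trans (cong length eq) (length-map length Y))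

IsColumn-resp-shape : ∀ {X Y} → shape X ≡ shape Y → IsColumn X → IsColumn Y
IsColumn-resp-shape eq col = All.map⁻ (subst (All (_≡ 1)) eq (All.map⁺ col))

column≡map[]concat : ∀ X → IsColumn X → X ≡ map [_] (concat X)
column≡map[]concat []                []      = refl
column≡map[]concat ((b ∷ []) ∷ X)    (_ ∷ col) = cong ((b ∷ []) ∷_) (column≡map[]concat X col)

column-entries-↗ : ∀ {X} → IsColumn X → Linked Below X → Linked _<_ (concat X)
column-entries-↗ {X} col X↓ =
  Linked.map proj₁ (Linkedₚ.map⁻ (subst (Linked Below) (column≡map[]concat X col) X↓))

∈-map-suc-upTo : ∀ {n} → 1 ≤ n → n ∈ map suc (upTo n)
∈-map-suc-upTo {suc n} _ = ∈-map⁺ suc (∈-upTo⁺ ≤-refl)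

module _ {n : ℕ} {T : Tableau} (T-syt : IsSYT n T) where
  open IsSYT T-syt

  entry-bounds : ∀ {x} → x ∈ concat T → 1 ≤ x × x ≤ n
  entry-bounds x∈ with ∈-map⁻ suc (∈-resp-↭ entries x∈)
  ... | _ , k∈ , refl = s≤s z≤n , ∈-upTo⁻ k∈

  length-entries : length (concat T) ≡ n
  length-entries = trans (↭-length entries) (trans (length-map suc (upTo n)) (length-upTo n))

  too-few-entries : 3 ≤ n → ¬ length (concat T) ≤ 2
  too-few-entries 3≤n ≤2 = <⇒≱ 3≤n (subst (_≤ 2) length-entries ≤2)

  n∈entries : 1 ≤ n → n ∈ concat T
  n∈entries 1≤n = ∈-resp-↭ (↭-sym entries) (∈-map-suc-upTo 1≤n)

  entries-↭ : ∀ {T′} → IsSYT n T′ → concat T ↭ concat T′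
  entries-↭ T′-syt = ↭-trans entries (↭-sym (IsSYT.entries T′-syt))

row-unique : ∀ {n r r′} → IsSYT n (r′ ∷ []) → IsSYT n (r ∷ []) → r′ ∷ [] ≡ r ∷ []
row-unique {r = r} {r′} r′-syt r-syt with IsSYT.rowsIncr r′-syt | IsSYT.rowsIncr r-syt
... | r′↗ ∷ [] | r↗ ∷ [] =
  cong [_] (↗↭↗⇒≡ r′↗ r↗ (subst₂ _↭_ (++-identityʳ r′) (++-identityʳ r) (entries-↭ r′-syt r-syt)))

column-unique : ∀ {n X Y} → IsSYT n X → IsSYT n Y → IsColumn X → IsColumn Y → X ≡ Y
column-unique {X = X} {Y} X-syt Y-syt X-col Y-col = begin
  X                   ≡⟨ column≡map[]concat X X-col ⟩
  map [_] (concat X)  ≡⟨ cong (map [_]) (↗↭↗⇒≡ (entries↗ X-syt X-col) (entries↗ Y-syt Y-col)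
                                                (entries-↭ X-syt Y-syt)) ⟩
  map [_] (concat Y)  ≡⟨ column≡map[]concat Y Y-col ⟨
  Y                   ∎
  where
  open ≡-Reasoning
  entries↗ : ∀ {n Z} → IsSYT n Z → IsColumn Z → Linked _<_ (concat Z)
  entries↗ Z-syt col = column-entries-↗ col (IsSYT.colsIncr Z-syt)

splitAt-just : ∀ {m} r {p s} → splitAt m r ≡ just (p , s) → r ≡ p ++ m ∷ s
splitAt-just {m} (x ∷ r) eq with m ≡ᵇ x in m≡ᵇx
... | true with refl ← eq = cong (_∷ r) (sym (≡ᵇ-true⇒≡ m≡ᵇx))
... | false with splitAt m r in eq′
...   | nothing with () ← eq
...   | just _  with refl ← eq = cong (x ∷_) (splitAt-just r eq′)

splitAt-nothing⇒∉ : ∀ {m} r → splitAt m r ≡ nothing → m ∉ r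
splitAt-nothing⇒∉ {m} (x ∷ r) eq m∈ with m ≡ᵇ x in m≡ᵇx
... | true with () ← eq
... | false with splitAt m r in eq′ | m∈
...   | just _  | _         with () ← eq
...   | nothing | here refl with () ← trans (sym m≡ᵇx) (≡ᵇ-refl m)
...   | nothing | there m∈r = splitAt-nothing⇒∉ r eq′ m∈r

removeCell-skip : ∀ {m} r rs → splitAt m r ≡ nothing → removeCell m (r ∷ rs) ≡ r ∷ removeCell m rs
removeCell-skip r rs eq rewrite eq = refl

removeCell-hit : ∀ {m p s} r rs → splitAt m r ≡ just (p , s) → removeCell m (r ∷ rs) ≡ slide p s rs
removeCell-hit r rs eq rewrite eq = refl

lookupM-last : ∀ p x → lookupM (p ++ x ∷ []) (length p) ≡ just x
lookupM-last []      x = refl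
lookupM-last (_ ∷ p) x = lookupM-last p x

lookupM⇒∈ : ∀ xs i {x} → lookupM xs i ≡ just x → x ∈ xs
lookupM⇒∈ (y ∷ xs) zero    refl = here refl
lookupM⇒∈ (y ∷ xs) (suc i) eq   = there (lookupM⇒∈ xs i eq)

Below-lookupM : ∀ xs ys i {b} → Below xs ys → lookupM ys i ≡ just b →
  ∃[ a ] lookupM xs i ≡ just a × a < b
Below-lookupM (x ∷ xs) (y ∷ ys) zero    (x<y , _) refl = x , refl , x<y
Below-lookupM (x ∷ xs) (y ∷ ys) (suc i) (_ , xs↓) eq   = Below-lookupM xs ys i xs↓ eq

data CornerRemoval (m : ℕ) : Tableau → Set where
  corner : ∀ above before below →
           removeCell m (above ++ (before ++ m ∷ []) ∷ below) ≡ above ++ stop before below →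
           CornerRemoval m (above ++ (before ++ m ∷ []) ∷ below)

max-ends-row : ∀ {m} p s → Linked _<_ (p ++ m ∷ s) → (∀ {x} → x ∈ s → x ≤ m) → s ≡ []
max-ends-row p []      _ _     = refl
max-ends-row p (x ∷ s) ↗ bound = ⊥-elim (<⇒≱ (Linked-<-adjacent p s ↗) (bound (here refl)))

-- Below the cell of the maximum there is no cell, so the hole left by it does not move.
slide-from-max : ∀ {m} p rs → Linked Below ((p ++ m ∷ []) ∷ rs) → (∀ {x} → x ∈ concat rs → x ≤ m) →
  slide p [] rs ≡ stop p rs
slide-from-max p [] _ _ = refl
slide-from-max {m} p (row ∷ rows) (↓ ∷ _) bound with lookupM row (length p) in eq
... | nothing = refl
... | just b with Below-lookupM (p ++ m ∷ []) row (length p) ↓ eq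
...   | a , a∈ , a<b with refl ← trans (sym a∈) (lookupM-last p m) =
  ⊥-elim (<⇒≱ a<b (bound (∈-++⁺ˡ (lookupM⇒∈ row (length p) eq))))

removeCell-max : ∀ {m} X → All (Linked _<_) X → Linked Below X →
  (∀ {x} → x ∈ concat X → x ≤ m) → m ∈ concat X → CornerRemoval m X
removeCell-max {m} (r ∷ rs) (r↗ ∷ rs↗) X↓ bound m∈ with splitAt m r in eq
... | just (p , s) with refl ← splitAt-just r eq
                   with refl ← max-ends-row p s r↗ (λ x∈ → bound (∈-++⁺ˡ (∈-++⁺ʳ p (there x∈)))) =
  corner [] p rs (trans (removeCell-hit (p ++ m ∷ []) rs eq)
                        (slide-from-max p rs X↓ (λ x∈ → bound (∈-++⁺ʳ _ x∈))))
... | nothing with ∈-++⁻ r m∈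
...   | inj₁ m∈r = ⊥-elim (splitAt-nothing⇒∉ r eq m∈r)
...   | inj₂ m∈rs with removeCell-max rs rs↗ (Linked.tail X↓) (λ x∈ → bound (∈-++⁺ʳ r x∈)) m∈rs
...     | corner above before below e =
  corner (r ∷ above) before below (trans (removeCell-skip r _ eq) (cong (r ∷_) e))

corner-of-max : ∀ {n T} → IsSYT n T → 1 ≤ n → CornerRemoval n T
corner-of-max T-syt 1≤n =
  removeCell-max _ rowsIncr colsIncr (λ x∈ → proj₂ (entry-bounds T-syt x∈)) (n∈entries T-syt 1≤n)
  where open IsSYT T-syt

slide₀-single-row : ∀ p s → length (slide₀ p s) ≤ 1
slide₀-single-row []      []      = z≤n
slide₀-single-row (_ ∷ _) []      = s≤s z≤n
slide₀-single-row p       (r ∷ s) = slide₀-single-row (p ++ r ∷ []) s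

removeCell-row : ∀ m r → length (removeCell m (r ∷ [])) ≤ 1
removeCell-row m r with splitAt m r
... | nothing      = s≤s z≤n
... | just (p , s) = slide₀-single-row p s

slide-column : ∀ rs → IsColumn rs → IsColumn (slide [] [] rs)
slide-column []                     []        = []
slide-column ((b ∷ []) ∷ [])         (_ ∷ _)   = refl ∷ []
slide-column ((b ∷ []) ∷ row ∷ rows) (_ ∷ col) = refl ∷ slide-column (row ∷ rows) col

removeCell-column : ∀ m X → IsColumn X → IsColumn (removeCell m X)
removeCell-column m []              []        = []
removeCell-column m ((y ∷ []) ∷ rs) (_ ∷ col) with m ≡ᵇ y
... | true  = slide-column rs col
... | false = refl ∷ removeCell-column m rs col

slide₁-past-cell : ∀ q pre suf x rows →
  slide₁ (q ∷ pre) suf (x ∷ []) rows ≡ (q ∷ pre ++ suf) ∷ (x ∷ []) ∷ rows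
slide₁-past-cell q pre []      x rows = cong (λ r → (q ∷ r) ∷ (x ∷ []) ∷ rows) (sym (++-identityʳ pre))
slide₁-past-cell q pre (r ∷ s) x rows =
  trans (slide₁-past-cell q (pre ++ r ∷ []) s x rows)
        (cong (λ r → (q ∷ r) ∷ (x ∷ []) ∷ rows) (++-assoc pre (r ∷ []) s))

removeCell-second : ∀ {a b} t x rows → a < b →
  removeCell b ((a ∷ b ∷ t) ∷ (x ∷ []) ∷ rows) ≡ (a ∷ t) ∷ (x ∷ []) ∷ rows
removeCell-second {a} {b} t x rows a<b rewrite ≢⇒≡ᵇ-false (>⇒≢ a<b) | ≡ᵇ-refl b =
  slide₁-past-cell a [] t x rows

removeCell-first : ∀ {x y} q rows → y ≤ x →
  removeCell q ((q ∷ x ∷ []) ∷ (y ∷ []) ∷ rows) ≡ (y ∷ x ∷ []) ∷ descend 0 (y ∷ []) rows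
removeCell-first q rows y≤x rewrite ≡ᵇ-refl q | ≤⇒<ᵇ-false y≤x = refl

SameMinors : ℕ → Tableau → Tableau → Set
SameMinors n T T′ = (S : Tableau) → IsMinor n T S ⇔ IsMinor n T′ S

shape-minus : ∀ T m → shape (T minus m) ≡ shape (removeCell m T)
shape-minus T m = trans (sym (map-∘ (removeCell m T))) (map-cong (length-map (renumber m)) (removeCell m T))

removeCell-shapes : ∀ {n T T′ m} → SameMinors n T T′ → 1 ≤ m → m ≤ n →
  ∃[ m′ ] shape (removeCell m′ T) ≡ shape (removeCell m T′)
removeCell-shapes {T = T} {T′} {m} same 1≤m m≤n
  with m′ , _ , _ , eq ← Equivalence.from (same (T′ minus m)) (m , 1≤m , m≤n , refl) =
  m′ , trans (sym (shape-minus T m′)) (trans (cong shape (sym eq)) (shape-minus T′ m))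

row-removals : ∀ {n r T′ m} → SameMinors n (r ∷ []) T′ → 1 ≤ m → m ≤ n →
  length (removeCell m T′) ≤ 1
row-removals {r = r} {T′} {m} same 1≤m m≤n
  with m′ , eq ← removeCell-shapes {T = r ∷ []} {T′} same 1≤m m≤n =
  subst (_≤ 1) (length-resp-shape {removeCell m′ (r ∷ [])} {removeCell m T′} eq) (removeCell-row m′ r)

column-removals : ∀ {n T T′ m} → IsColumn T → SameMinors n T T′ → 1 ≤ m → m ≤ n →
  IsColumn (removeCell m T′)
column-removals {T = T} {T′} {m} col same 1≤m m≤n
  with m′ , eq ← removeCell-shapes {T = T} {T′} same 1≤m m≤n =
  IsColumn-resp-shape {removeCell m′ T} {removeCell m T′} eq (removeCell-column m′ T col)

row-corner-cases : ∀ {n r} above before below → 3 ≤ n → IsSYT n (r ∷ []) →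
  IsSYT n (above ++ (before ++ n ∷ []) ∷ below) →
  (∀ {m} → 1 ≤ m → m ≤ n → length (removeCell m (above ++ (before ++ n ∷ []) ∷ below)) ≤ 1) →
  length (above ++ stop before below) ≤ 1 →
  above ++ (before ++ n ∷ []) ∷ below ≡ r ∷ []
row-corner-cases []                 p       []          _   r-syt T′-syt _ _ = row-unique T′-syt r-syt
row-corner-cases []                 []      (x ∷ [])    3≤n _     T′-syt _ _ with IsSYT.partition T′-syt
... | x≤1 ∷ _ =
  ⊥-elim (too-few-entries T′-syt 3≤n (s≤s (subst (_≤ 1) (cong length (sym (++-identityʳ x))) x≤1)))
row-corner-cases ([] ∷ [])          []      []          3≤n _     T′-syt _ _ =
  ⊥-elim (too-few-entries T′-syt 3≤n (s≤s z≤n))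
row-corner-cases ((a ∷ []) ∷ [])    []      []          3≤n _     T′-syt _ _ =
  ⊥-elim (too-few-entries T′-syt 3≤n (s≤s (s≤s z≤n)))
row-corner-cases ((a ∷ b ∷ t) ∷ []) []      []          _   _     T′-syt one-row _
  with (a<b ∷ _) ∷ _ ← IsSYT.rowsIncr T′-syt
  with 1≤b , b≤n ← entry-bounds T′-syt (there (here refl)) =
  ⊥-elim (1+n≰n (subst (λ X → length X ≤ 1) (removeCell-second t _ [] a<b) (one-row 1≤b b≤n)))
row-corner-cases []                 []      (_ ∷ _ ∷ _) _ _ _ _ (s≤s ())
row-corner-cases []                 (_ ∷ _) (_ ∷ _)     _ _ _ _ (s≤s ())
row-corner-cases (_ ∷ [])           []      (_ ∷ _)     _ _ _ _ (s≤s ())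
row-corner-cases (_ ∷ [])           (_ ∷ _) _           _ _ _ _ (s≤s ())
row-corner-cases (_ ∷ _ ∷ _)        _       _           _ _ _ _ (s≤s ())

row-reconstruction : ∀ {n r T′} → 3 ≤ n → IsSYT n (r ∷ []) → IsSYT n T′ →
  (∀ {m} → 1 ≤ m → m ≤ n → length (removeCell m T′) ≤ 1) → T′ ≡ r ∷ []
row-reconstruction 3≤n r-syt T′-syt one-row with corner-of-max T′-syt (m<n⇒0<n 3≤n)
... | corner above before below eq =
  row-corner-cases above before below 3≤n r-syt T′-syt one-row
    (subst (λ X → length X ≤ 1) eq (one-row (m<n⇒0<n 3≤n) ≤-refl))

column-corner-cases : ∀ {n T} above before below → 3 ≤ n → IsSYT n T → IsColumn T →
  IsSYT n (above ++ (before ++ n ∷ []) ∷ below) →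
  (∀ {m} → 1 ≤ m → m ≤ n → IsColumn (removeCell m (above ++ (before ++ n ∷ []) ∷ below))) →
  IsColumn (above ++ stop before below) →
  above ++ (before ++ n ∷ []) ∷ below ≡ T
column-corner-cases above []          below _ T-syt T-col T′-syt _ col =
  column-unique T′-syt T-syt (All.++⁺ (All.++⁻ˡ above col) (refl ∷ All.++⁻ʳ above col)) T-col
column-corner-cases above (_ ∷ _ ∷ _) below _ _ _ _ _ col with () ∷ _ ← All.++⁻ʳ above col
column-corner-cases (y ∷ above) (q ∷ []) below _ _ _ T′-syt _ (y≡1 ∷ col)
  with 2≤y ∷ _ ← All.++⁻ʳ above (rows-no-longer-than-first {y} (IsSYT.partition T′-syt)) =
  ⊥-elim (1+n≰n (subst (2 ≤_) y≡1 2≤y))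
column-corner-cases [] (q ∷ []) [] 3≤n _ _ T′-syt _ _ =
  ⊥-elim (too-few-entries T′-syt 3≤n (s≤s (s≤s z≤n)))
column-corner-cases [] (q ∷ []) ([] ∷ _)          _ _ _ _ _ (_ ∷ () ∷ _)
column-corner-cases [] (q ∷ []) ((_ ∷ _ ∷ _) ∷ _) _ _ _ _ _ (_ ∷ () ∷ _)
column-corner-cases [] (q ∷ []) ((y ∷ []) ∷ rows) _ _ _ T′-syt one-cell-rows _
  with 1≤q , q≤n ← entry-bounds T′-syt (here refl)
  with _ , y≤n ← entry-bounds T′-syt (there (there (here refl)))
  with () ∷ _ ← subst IsColumn (removeCell-first q rows y≤n) (one-cell-rows 1≤q q≤n)

column-reconstruction : ∀ {n T T′} → 3 ≤ n → IsSYT n T → IsColumn T → IsSYT n T′ →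
  (∀ {m} → 1 ≤ m → m ≤ n → IsColumn (removeCell m T′)) → T′ ≡ T
column-reconstruction 3≤n T-syt T-col T′-syt one-cell-rows
  with corner-of-max T′-syt (m<n⇒0<n 3≤n)
... | corner above before below eq =
  column-corner-cases above before below 3≤n T-syt T-col T′-syt one-cell-rows
    (subst IsColumn eq (one-cell-rows (m<n⇒0<n 3≤n) ≤-refl))

column-shape⇒IsColumn : ∀ {n} T → shape T ≡ replicate n 1 → IsColumn T
column-shape⇒IsColumn {n} T eq = All.map⁻ (subst (All (_≡ 1)) (sym eq) (All.replicate⁺ n refl))

mainTheorem4 : (n : ℕ) → 3 ≤ n → (T : Tableau) → IsSYT n T → RowOrColumn n T →
    (T′ : Tableau) → IsSYT n T′ →
    ((S : Tableau) → IsMinor n T S ⇔ IsMinor n T′ S) →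
    T′ ≡ T
mainTheorem4 n 3≤n (r ∷ [])    T-syt (inj₁ _)  T′ T′-syt same =
  row-reconstruction 3≤n T-syt T′-syt (row-removals {r = r} {T′} same)
mainTheorem4 n 3≤n []          _     (inj₁ ())
mainTheorem4 n 3≤n (_ ∷ _ ∷ _) _     (inj₁ ())
mainTheorem4 n 3≤n T           T-syt (inj₂ T-col) T′ T′-syt same =
  column-reconstruction 3≤n T-syt column T′-syt (column-removals {T′ = T′} column same)
  where
  column : IsColumn T
  column = column-shape⇒IsColumn T T-col
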